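{- Let $k$ be a positive integer. In any graph $G$, every vertex belonging to an adjacency resolving set of $G$ of size $k$ has degree at most $2^{k-1}+k-1$. Moreover, this bound is sharp: for every positive integer $k$ there exist a graph $G$ and an adjacency resolving set of $G$ of size $k$ containing a vertex of degree $2^{k-1}+k-1$.
   Context: Graphs are finite, simple, undirected, possibly disconnected; $\textnormal{dist}(u,v)=\infty$ between different components. A set $S=\{v_1,\dots,v_k\}$ of vertices is an adjacency resolving set of $G$ if the vectors $(\min(2,\textnormal{dist}(u,v_1)),\dots,\min(2,\textnormal{dist}(u,v_k)))$ are pairwise distinct over $u\in V(G)$. -}

module Defs where

open import Data.Nat using (ℕ; zero; suc; _+_)
open import Data.Bool using (Bool; true; false; if_then_else_)
open import Data.Fin using (Fin; _≟_)
open import Data.List using (map; allFin)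
open import Data.Nat.ListAction using (sum)
open import Data.Product using (_×_)
open import Relation.Binary.PropositionalEquality using (_≡_)
open import Relation.Nullary using (¬_; yes; no)
open import Function.Definitions using (Injective)

record Graph (n : ℕ) : Set where
  field
    adj   : Fin n → Fin n → Bool
    sym   : ∀ u v → adj u v ≡ adj v u
    irrefl : ∀ u → adj u u ≡ false
open Graph public

degree : ∀ {n} → Graph n → Fin n → ℕ
degree G u = sum (map (λ v → if adj G u v then 1 else 0) (allFin _))

-- min(2, dist(u,v)): 0 if u = v, 1 if adjacent, 2 otherwise
-- (this covers dist = ∞ between different components as well)
adjDist : ∀ {n} → Graph n → Fin n → Fin n → ℕ
adjDist G u v with u ≟ v
... | yes _ = 0
... | no _  = if adj G u v then 1 else 2

IsAdjResolvingSet : ∀ {n k} → Graph n → (Fin k → Fin n) → Set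
IsAdjResolvingSet {n} {k} G S =
  Injective _≡_ _≡_ S × (∀ (u w : Fin n) → (∀ (i : Fin k) → adjDist G u (S i) ≡ adjDist G w (S i)) → u ≡ w)

-- A neighbour u of S i is either another vertex S j of the resolving set, or it lies
-- outside S; in the latter case u is determined by which of the k - 1 vertices S j,
-- j ≢ i, it is adjacent to (it is adjacent to S i anyway). Hence S i has at most
-- (k - 1) + 2^(k-1) neighbours. For sharpness take a hub S 0 joined to k - 1 further
-- vertices of S and to one vertex for every subset of those k - 1 vertices, that
-- vertex being adjacent to exactly the members of its subset.
module Submission where

open import Defs
open import Data.Nat using (ℕ; _+_; _∸_; _^_; _≤_)
open import Data.Fin using (Fin)
open import Data.Product using (_×_; Σ; ∃)
open import Relation.Binary.PropositionalEquality using (_≡_)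

open import Data.Nat using (zero; suc; z≤n; s≤s)
open import Data.Nat.Properties using (+-suc; +-comm)
open import Data.Fin using (zero; suc; _↑ˡ_; _↑ʳ_; splitAt; join; punchIn; punchOut; _≟_; combine; funToFin; finToFun)
open import Data.Fin.Properties
  using ( suc-injective; ↑ˡ-injective; ↑ʳ-injective; splitAt-↑ˡ; splitAt-↑ʳ; join-splitAt
        ; punchOut-injective; punchIn-punchOut; any?; 0≢1+n; finToFun-funToFin; funToFin-finToFin; 2↔Bool)
open import Data.Bool using (Bool; true; false; if_then_else_)
open import Data.Sum using (_⊎_; inj₁; inj₂)
open import Data.Product using (_,_)
open import Data.List using (map; allFin)
open import Data.List.Properties using (map-tabulate)
open import Data.Nat.ListAction using (sum)
open import Data.Empty using (⊥-elim)
open import Function using (_∘_; id; Inverse)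
open import Function.Definitions using (Injective)
open import Relation.Nullary using (¬_; yes; no; Dec)
open import Relation.Binary.PropositionalEquality
  using (refl; trans; cong; cong₂; subst; _≢_; _≗_; module ≡-Reasoning)
import Relation.Binary.PropositionalEquality as ≡

countTrue : ∀ n → (Fin n → Bool) → ℕ
countTrue n p = sum (map (λ v → if p v then 1 else 0) (allFin n))

countTrue-suc : ∀ n (p : Fin (suc n) → Bool) →
  countTrue (suc n) p ≡ (if p zero then 1 else 0) + countTrue n (p ∘ suc)
countTrue-suc n p = cong (λ xs → (if p zero then 1 else 0) + sum xs)
  (trans (map-tabulate suc indicator) (≡.sym (map-tabulate id (indicator ∘ suc))))
  where
  indicator : Fin (suc n) → ℕ
  indicator v = if p v then 1 else 0

countTrue-true : ∀ n → countTrue n (λ _ → true) ≡ n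
countTrue-true zero    = refl
countTrue-true (suc n) = trans (countTrue-suc n (λ _ → true)) (cong suc (countTrue-true n))

-- The pigeonhole argument of injective⇒≤, restricted to the vertices where p holds.
countTrue≤ : ∀ n m (p : Fin n → Bool) (f : ∀ v → p v ≡ true → Fin m) →
  (∀ u w pu pw → f u pu ≡ f w pw → u ≡ w) → countTrue n p ≤ m
countTrue≤ zero m p f inj = z≤n
countTrue≤ (suc n) m p f inj rewrite countTrue-suc n p with p zero in p0
... | false = countTrue≤ n m (p ∘ suc) (f ∘ suc) (λ u w pu pw → suc-injective ∘ inj (suc u) (suc w) pu pw)
countTrue≤ (suc n) zero    p f inj | true with () ← f zero p0
countTrue≤ (suc n) (suc m) p f inj | true = s≤s (countTrue≤ n m (p ∘ suc) f′ inj′)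
  where
  f₀≢f : ∀ w pw → f zero p0 ≢ f (suc w) pw
  f₀≢f w pw = 0≢1+n ∘ inj zero (suc w) p0 pw
  f′ : ∀ w → p (suc w) ≡ true → Fin m
  f′ w pw = punchOut (f₀≢f w pw)
  inj′ : ∀ u w pu pw → f′ u pu ≡ f′ w pw → u ≡ w
  inj′ u w pu pw = suc-injective ∘ inj (suc u) (suc w) pu pw ∘ punchOut-injective (f₀≢f u pu) (f₀≢f w pw)

funToFin-cong : ∀ {m n} {f g : Fin m → Fin n} → f ≗ g → funToFin f ≡ funToFin g
funToFin-cong {zero}  f≗g = refl
funToFin-cong {suc m} f≗g = cong₂ combine (f≗g zero) (funToFin-cong (f≗g ∘ suc))

module _ {k : ℕ} where
  open Inverse 2↔Bool using (to; from; strictlyInverseˡ; strictlyInverseʳ)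

  bitsToFin : (Fin k → Bool) → Fin (2 ^ k)
  bitsToFin b = funToFin (from ∘ b)

  finToBits : Fin (2 ^ k) → Fin k → Bool
  finToBits t = to ∘ finToFun t

  finToBits-bitsToFin : ∀ b → finToBits (bitsToFin b) ≗ b
  finToBits-bitsToFin b j = trans (cong to (finToFun-funToFin (from ∘ b) j)) (strictlyInverseˡ (b j))

  bitsToFin-finToBits : ∀ t → bitsToFin (finToBits t) ≡ t
  bitsToFin-finToBits t = trans (funToFin-cong {k} (strictlyInverseʳ ∘ finToFun t)) (funToFin-finToFin {k} {2} t)

  bitsToFin-injective : ∀ {b b′} → bitsToFin b ≡ bitsToFin b′ → b ≗ b′
  bitsToFin-injective {b} {b′} eq j =
    trans (≡.sym (finToBits-bitsToFin b j)) (trans (cong (λ t → finToBits t j) eq) (finToBits-bitsToFin b′ j))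

  finToBits-injective : ∀ {t t′} → finToBits t ≗ finToBits t′ → t ≡ t′
  finToBits-injective {t} {t′} eq =
    trans (≡.sym (bitsToFin-finToBits t)) (trans (funToFin-cong {k} (cong from ∘ eq)) (bitsToFin-finToBits t′))

↑ˡ≢↑ʳ : ∀ {m n} (i : Fin m) (j : Fin n) → i ↑ˡ n ≢ m ↑ʳ j
↑ˡ≢↑ʳ {m} {n} i j eq with () ← trans (≡.sym (splitAt-↑ˡ m i n)) (trans (cong (splitAt m) eq) (splitAt-↑ʳ m n j))

oneOrTwo : Bool → ℕ
oneOrTwo b = if b then 1 else 2

oneOrTwo-injective : ∀ {b c} → oneOrTwo b ≡ oneOrTwo c → b ≡ c
oneOrTwo-injective {true}  {true}  _ = refl
oneOrTwo-injective {false} {false} _ = refl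
oneOrTwo-injective {true}  {false} ()
oneOrTwo-injective {false} {true}  ()

≗-punchIn : ∀ {n} {A : Set} {f g : Fin (suc n) → A} (i : Fin (suc n)) →
  f i ≡ g i → (∀ j → f (punchIn i j) ≡ g (punchIn i j)) → f ≗ g
≗-punchIn {f = f} {g} i fi≡gi agree l with i ≟ l
... | yes refl = fi≡gi
... | no i≢l   = subst (λ x → f x ≡ g x) (punchIn-punchOut i≢l) (agree (punchOut i≢l))

module _ {n : ℕ} (G : Graph n) where

  adjDist-self : ∀ u → adjDist G u u ≡ 0
  adjDist-self u with u ≟ u
  ... | yes _ = refl
  ... | no u≢u = ⊥-elim (u≢u refl)

  adjDist-≢ : ∀ {u v} → u ≢ v → adjDist G u v ≡ oneOrTwo (adj G u v)
  adjDist-≢ {u} {v} u≢v with u ≟ v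
  ... | yes u≡v = ⊥-elim (u≢v u≡v)
  ... | no _    = refl

  adjDist≡0⇒≡ : ∀ u v → adjDist G u v ≡ 0 → u ≡ v
  adjDist≡0⇒≡ u v d≡0 with u ≟ v
  ... | yes u≡v = u≡v
  adjDist≡0⇒≡ u v d≡0 | no _ with adj G u v
  adjDist≡0⇒≡ u v () | no _ | true
  adjDist≡0⇒≡ u v () | no _ | false

  SameDistances : ∀ {k} → (Fin k → Fin n) → Fin n → Fin n → Set
  SameDistances S u w = ∀ l → adjDist G u (S l) ≡ adjDist G w (S l)

  sameDistances-image : ∀ {k} {S : Fin k → Fin n} {u w l} → SameDistances S u w → S l ≡ u → u ≡ w
  sameDistances-image {S = S} {u} {w} {l} same refl = ≡.sym (
    adjDist≡0⇒≡ w (S l) (trans (≡.sym (same l)) (adjDist-self (S l))))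

  adjDist-outside : ∀ {k} {S : Fin k → Fin n} {u} → ¬ (∃ λ j → S j ≡ u) →
    ∀ l → adjDist G u (S l) ≡ oneOrTwo (adj G u (S l))
  adjDist-outside u∉S l = adjDist-≢ (λ u≡Sl → u∉S (l , ≡.sym u≡Sl))

module DegreeBound {n k} (G : Graph n) (S : Fin (suc k) → Fin n)
  (resolves : ∀ u w → SameDistances G S u w → u ≡ w) (i : Fin (suc k)) where

  Neighbour : Fin n → Set
  Neighbour u = adj G (S i) u ≡ true

  neighbourIndex≢ : ∀ {u j} → Neighbour u → S j ≡ u → i ≢ j
  neighbourIndex≢ {u} nu refl refl with () ← trans (≡.sym nu) (irrefl G (S i))

  bitsOutside : Fin n → Fin k → Bool
  bitsOutside u j = adj G u (S (punchIn i j))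

  -- Adjacency to S i is known for a neighbour, so the other k bits determine it.
  outsideNeighbour-unique : ∀ {u w} → Neighbour u → Neighbour w →
    ¬ (∃ λ j → S j ≡ u) → ¬ (∃ λ j → S j ≡ w) → bitsOutside u ≗ bitsOutside w → u ≡ w
  outsideNeighbour-unique {u} {w} nu nw u∉S w∉S same-bits = resolves u w λ l → begin
    adjDist G u (S l)         ≡⟨ adjDist-outside G u∉S l ⟩
    oneOrTwo (adj G u (S l))  ≡⟨ cong oneOrTwo (same-adjacency l) ⟩
    oneOrTwo (adj G w (S l))  ≡⟨ adjDist-outside G w∉S l ⟨
    adjDist G w (S l)         ∎
    where
    open ≡-Reasoning
    same-adjacency : (λ l → adj G u (S l)) ≗ (λ l → adj G w (S l))
    same-adjacency = ≗-punchIn i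
      (trans (Graph.sym G u (S i)) (trans nu (≡.sym (trans (Graph.sym G w (S i)) nw)))) same-bits

  codeWith : ∀ u → Neighbour u → Dec (∃ λ j → S j ≡ u) → Fin (2 ^ k + k)
  codeWith u nu (yes (j , Sj≡u)) = 2 ^ k ↑ʳ punchOut (neighbourIndex≢ nu Sj≡u)
  codeWith u nu (no _)           = bitsToFin (bitsOutside u) ↑ˡ k

  codeWith-injective : ∀ {u w} nu nw du dw → codeWith u nu du ≡ codeWith w nw dw → u ≡ w
  codeWith-injective nu nw (yes (j , Sj≡u)) (yes (j′ , Sj′≡w)) eq = trans (≡.sym Sj≡u) (trans (cong S j≡j′) Sj′≡w)
    where
    j≡j′ : j ≡ j′
    j≡j′ = punchOut-injective (neighbourIndex≢ nu Sj≡u) (neighbourIndex≢ nw Sj′≡w) (↑ʳ-injective _ _ _ eq)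
  codeWith-injective nu nw (yes _)   (no _)    eq = ⊥-elim (↑ˡ≢↑ʳ _ _ (≡.sym eq))
  codeWith-injective nu nw (no _)    (yes _)   eq = ⊥-elim (↑ˡ≢↑ʳ _ _ eq)
  codeWith-injective nu nw (no u∉S) (no w∉S) eq =
    outsideNeighbour-unique nu nw u∉S w∉S (bitsToFin-injective (↑ˡ-injective _ _ _ eq))

  inS? : ∀ u → Dec (∃ λ j → S j ≡ u)
  inS? u = any? (λ j → S j ≟ u)

  degree≤ : degree G (S i) ≤ 2 ^ k + k
  degree≤ = countTrue≤ n (2 ^ k + k) (adj G (S i)) (λ u nu → codeWith u nu (inS? u))
    (λ u w nu nw → codeWith-injective nu nw (inS? u) (inS? w))

module Extremal (k : ℕ) where

  P : ℕ
  P = 2 ^ k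

  Vertex : Set
  Vertex = Fin (suc k + P)

  S : Fin (suc k) → Vertex
  S i = i ↑ˡ P

  extra : Fin P → Vertex
  extra t = suc k ↑ʳ t

  spoke : Fin k ⊎ Fin P → Fin k ⊎ Fin P → Bool
  spoke (inj₁ j) (inj₂ t) = finToBits t j
  spoke (inj₂ t) (inj₁ j) = finToBits t j
  spoke (inj₁ _) (inj₁ _) = false
  spoke (inj₂ _) (inj₂ _) = false

  edge : Vertex → Vertex → Bool
  edge zero    zero    = false
  edge zero    (suc _) = true
  edge (suc _) zero    = true
  edge (suc a) (suc b) = spoke (splitAt k a) (splitAt k b)

  spoke-sym : ∀ x y → spoke x y ≡ spoke y x
  spoke-sym (inj₁ _) (inj₂ _) = refl
  spoke-sym (inj₂ _) (inj₁ _) = refl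
  spoke-sym (inj₁ _) (inj₁ _) = refl
  spoke-sym (inj₂ _) (inj₂ _) = refl

  edge-sym : ∀ u v → edge u v ≡ edge v u
  edge-sym zero    zero    = refl
  edge-sym zero    (suc _) = refl
  edge-sym (suc _) zero    = refl
  edge-sym (suc a) (suc b) = spoke-sym (splitAt k a) (splitAt k b)

  edge-irrefl : ∀ u → edge u u ≡ false
  edge-irrefl zero    = refl
  edge-irrefl (suc a) with splitAt k a
  ... | inj₁ _ = refl
  ... | inj₂ _ = refl

  H : Graph (suc k + P)
  H = record { adj = edge ; sym = edge-sym ; irrefl = edge-irrefl }

  S-injective : Injective _≡_ _≡_ S
  S-injective = ↑ˡ-injective P _ _

  vertexCases : ∀ u → (∃ λ i → S i ≡ u) ⊎ (∃ λ t → extra t ≡ u)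
  vertexCases u with splitAt (suc k) u in eq
  ... | inj₁ i = inj₁ (i , trans (cong (join (suc k) P) (≡.sym eq)) (join-splitAt (suc k) P u))
  ... | inj₂ t = inj₂ (t , trans (cong (join (suc k) P) (≡.sym eq)) (join-splitAt (suc k) P u))

  adjDist-extra : ∀ t j → adjDist H (extra t) (S (suc j)) ≡ oneOrTwo (finToBits t j)
  adjDist-extra t j = trans (adjDist-≢ H (↑ˡ≢↑ʳ (suc j) t ∘ ≡.sym)) (cong oneOrTwo edge-extra)
    where
    edge-extra : edge (extra t) (S (suc j)) ≡ finToBits t j
    edge-extra rewrite splitAt-↑ʳ k P t | splitAt-↑ˡ k j P = refl

  resolves : ∀ u w → SameDistances H S u w → u ≡ w
  resolves u w same with vertexCases u | vertexCases w
  ... | inj₁ (_ , Si≡u) | _               = sameDistances-image H same Si≡u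
  ... | inj₂ _          | inj₁ (_ , Si≡w) = ≡.sym (sameDistances-image H (≡.sym ∘ same) Si≡w)
  ... | inj₂ (t , refl) | inj₂ (t′ , refl) = cong extra (finToBits-injective λ j → oneOrTwo-injective
    (trans (≡.sym (adjDist-extra t j)) (trans (same (suc j)) (adjDist-extra t′ j))))

  isAdjResolvingSet : IsAdjResolvingSet H S
  isAdjResolvingSet = S-injective , resolves

  degree-hub : degree H (S zero) ≡ 2 ^ k + k
  degree-hub = trans (countTrue-suc (k + P) (edge zero)) (trans (countTrue-true (k + P)) (+-comm k P))

-- Note that 2 ^ (k ∸ 1) + k ∸ 1 parses as (2 ^ (k ∸ 1) + k) ∸ 1.
bound-suc : ∀ k → 2 ^ k + k ≡ 2 ^ (suc k ∸ 1) + suc k ∸ 1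
bound-suc k = cong (_∸ 1) (≡.sym (+-suc (2 ^ k) k))

theorem16 : (k : ℕ) → 1 ≤ k →
    ((n : ℕ) (G : Graph n) (S : Fin k → Fin n) → IsAdjResolvingSet G S →
       (i : Fin k) → degree G (S i) ≤ 2 ^ (k ∸ 1) + k ∸ 1)
    × Σ ℕ (λ n → Σ (Graph n) (λ G → Σ (Fin k → Fin n) (λ S →
        IsAdjResolvingSet G S × ∃ (λ (i : Fin k) → degree G (S i) ≡ 2 ^ (k ∸ 1) + k ∸ 1))))
theorem16 (suc k) _ = upper , (suc k + P , H , S , isAdjResolvingSet , zero , trans degree-hub (bound-suc k))
  where
  upper : ∀ n (G : Graph n) T → IsAdjResolvingSet G T → ∀ i → degree G (T i) ≤ 2 ^ k + suc k ∸ 1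
  upper n G T (_ , T-resolves) i = subst (degree G (T i) ≤_) (bound-suc k) (DegreeBound.degree≤ G T T-resolves i)

  open Extremal k
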